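{- For every strongly normalising $\lambda\mu$-term $M$ there exist a basis $\Gamma$, a name context $\Delta$ and a term type $\delta$ such that $\Gamma\vdash M:\delta\mid\Delta$ is derivable in the intersection type system described in the context.
   Context: Pure $\lambda\mu$-calculus: given disjoint denumerable sets of term variables $x,y,\dots$ and names $\alpha,\beta,\dots$, terms are $M,N ::= x \mid \lambda x.M \mid MN \mid \mu\alpha.C$ and commands are $C ::= [\alpha]M$; $\lambda$ binds $x$ and $\mu$ binds $\alpha$; terms are taken modulo renaming of bound variables/names, with bound and free variables/names kept distinct. Structural substitution $T[\alpha\Leftarrow L]$ (for $T$ a term or command) replaces every subcommand $[\alpha]N$ by $[\alpha](N[\alpha\Leftarrow L])L$ and commutes with all other constructs. Reduction $\to$ is the compatible closure of $(\lambda x.M)N \to M[N/x]$ and $(\mu\beta.C)N \to \mu\beta.(C[\beta\Leftarrow N])$. A term is strongly normalising if it has no infinite reduction sequence. Types: with a single type constant $\nu$ and a symbol $\omega$ (which is not itself a type), term types are $\delta ::= \nu \mid \omega\to\nu \mid \kappa\to\nu \mid \delta\wedge\delta$ and stack types are $\kappa ::= \delta\times\omega \mid \delta\times\kappa \mid \kappa\wedge\kappa$. The relation $\le$ is the least preorder such that: $\sigma\wedge\tau\le\sigma$; $\sigma\wedge\tau\le\tau$; $\nu\le\omega\to\nu$; $\omega\to\nu\le\nu$; $\delta_1\times\delta_2\times\omega\le\delta_1\times\omega$; $(\delta_1\times\omega)\wedge(\delta_2\times\kappa)\le(\delta_1\wedge\delta_2)\times\kappa$; $(\delta_1\times\kappa_1)\wedge(\delta_2\times\kappa_2)\le(\delta_1\wedge\delta_2)\times(\kappa_1\wedge\kappa_2)$;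 if $\delta_1\le\delta_2$ then $\delta_1\times\omega\le\delta_2\times\omega$; if $\delta_1\le\delta_2$ and $\kappa_1\le\kappa_2$ then $\delta_1\times\kappa_1\le\delta_2\times\kappa_2$; if $\sigma\le\tau_1$ and $\sigma\le\tau_2$ then $\sigma\le\tau_1\wedge\tau_2$; if $\kappa_2\le\kappa_1$ then $\kappa_1\to\nu\le\kappa_2\to\nu$. A basis $\Gamma$ is a finite map from term variables to term types, a name context $\Delta$ a finite map from names to stack types (written as sets of $x{:}\delta$, $\alpha{:}\kappa$; a comma denotes disjoint extension). Typing rules: (ax) $\Gamma,x{:}\delta\vdash x:\delta\mid\Delta$; (abs) from $\Gamma,x{:}\delta\vdash M:\kappa\to\nu\mid\Delta$ infer $\Gamma\vdash\lambda x.M:\delta\times\kappa\to\nu\mid\Delta$; (app) from $\Gamma\vdash M:\delta\times\kappa\to\nu\mid\Delta$ and $\Gamma\vdash N:\delta\mid\Delta$ infer $\Gamma\vdash MN:\kappa\to\nu\mid\Delta$, where in (abs), (app) $\kappa$ is either a stack type or $\omega$; ($\mu$) from $\Gamma\vdash M:\kappa\to\nu\mid\alpha{:}\kappa,\Delta$ infer $\Gamma\vdash\mu\alpha.[\alpha]M:\kappa\to\nu\mid\Delta$, and, for $\alpha\neq\beta$, from $\Gamma\vdash M:\kappa'\to\nu\mid\alpha{:}\kappa,\beta{:}\kappa',\Delta$ infer $\Gamma\vdash\mu\alpha.[\beta]M:\kappa\to\nu\mid\beta{:}\kappa',\Delta$; ($\le$) from $\Gamma\vdash M:\delta\mid\Delta$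 and $\delta\le\delta'$ infer $\Gamma\vdash M:\delta'\mid\Delta$; ($\wedge$) from $\Gamma\vdash M:\delta\mid\Delta$ and $\Gamma\vdash M:\delta'\mid\Delta$ infer $\Gamma\vdash M:\delta\wedge\delta'\mid\Delta$. Variables in $\Gamma$ and names in $\Delta$ are never bound in $M$. -}

module Defs where

open import Data.Nat using (ℕ; zero; suc)
open import Data.Fin using (Fin; zero; suc)
open import Data.Fin.Properties using (_≟_)
open import Relation.Nullary using (yes; no)
open import Data.Vec.Functional using (Vector; _∷_)
open import Induction.WellFounded using (Acc)

-- Term n m : terms whose free term variables are among Fin n and whose
-- free names are among Fin m.  Index zero is the most recently bound.
-- Terms are thereby automatically taken modulo α-renaming, and bound
-- variables/names are distinct from free ones.

mutual
  data Term (n m : ℕ) : Set where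
    var : Fin n → Term n m
    lam : Term (suc n) m → Term n m
    app : Term n m → Term n m → Term n m
    mu  : Cmd n (suc m) → Term n m

  data Cmd (n m : ℕ) : Set where
    [_]_ : Fin m → Term n m → Cmd n m

private
  variable
    n n' m m' : ℕ

ext : (Fin n → Fin n') → Fin (suc n) → Fin (suc n')
ext ρ zero    = zero
ext ρ (suc i) = suc (ρ i)

mutual
  renV : (Fin n → Fin n') → Term n m → Term n' m
  renV ρ (var x)   = var (ρ x)
  renV ρ (lam M)   = lam (renV (ext ρ) M)
  renV ρ (app M N) = app (renV ρ M) (renV ρ N)
  renV ρ (mu C)    = mu (renVC ρ C)

  renVC : (Fin n → Fin n') → Cmd n m → Cmd n' m
  renVC ρ ([ a ] M) = [ a ] renV ρ M

mutual
  renN : (Fin m → Fin m') → Term n m → Term n m'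
  renN ρ (var x)   = var x
  renN ρ (lam M)   = lam (renN ρ M)
  renN ρ (app M N) = app (renN ρ M) (renN ρ N)
  renN ρ (mu C)    = mu (renNC (ext ρ) C)

  renNC : (Fin m → Fin m') → Cmd n m → Cmd n m'
  renNC ρ ([ a ] M) = [ ρ a ] renN ρ M

exts : (Fin n → Term n' m) → Fin (suc n) → Term (suc n') m
exts σ zero    = var zero
exts σ (suc i) = renV suc (σ i)

mutual
  sub : (Fin n → Term n' m) → Term n m → Term n' m
  sub σ (var x)   = σ x
  sub σ (lam M)   = lam (sub (exts σ) M)
  sub σ (app M N) = app (sub σ M) (sub σ N)
  sub σ (mu C)    = mu (subC (λ i → renN suc (σ i)) C)

  subC : (Fin n → Term n' m) → Cmd n m → Cmd n' m
  subC σ ([ a ] M) = [ a ] sub σ M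

_[_/0] : Term (suc n) m → Term n m → Term n m
M [ N /0] = sub σ M
  where
    σ : Fin (suc _) → Term _ _
    σ zero    = N
    σ (suc i) = var i

-- structural substitution  T[α ⇐ L]  (strT α L T):
-- every subcommand [α]N becomes [α](N[α⇐L])L, commuting with all else.
mutual
  strT : Fin m → Term n m → Term n m → Term n m
  strT a L (var x)   = var x
  strT a L (lam M)   = lam (strT a (renV suc L) M)
  strT a L (app M N) = app (strT a L M) (strT a L N)
  strT a L (mu C)    = mu (strC (suc a) (renN suc L) C)

  strC : Fin m → Term n m → Cmd n m → Cmd n m
  strC a L ([ b ] M) with b ≟ a
  ... | yes _ = [ b ] app (strT a L M) L
  ... | no  _ = [ b ] strT a L M

mutual
  data _⟶_ : {n m : ℕ} → Term n m → Term n m → Set where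
    β    : {M : Term (suc n) m} {N : Term n m} →
           app (lam M) N ⟶ (M [ N /0])
    μred : {C : Cmd n (suc m)} {N : Term n m} →
           app (mu C) N ⟶ mu (strC zero (renN suc N) C)
    ξlam : {M M' : Term (suc n) m} → M ⟶ M' → lam M ⟶ lam M'
    ξl   : {M M' N : Term n m} → M ⟶ M' → app M N ⟶ app M' N
    ξr   : {M N N' : Term n m} → N ⟶ N' → app M N ⟶ app M N'
    ξmu  : {C C' : Cmd n (suc m)} → C ⟶C C' → mu C ⟶ mu C'

  data _⟶C_ : {n m : ℕ} → Cmd n m → Cmd n m → Set where
    ξcmd : {a : Fin m} {M M' : Term n m} → M ⟶ M' → ([ a ] M) ⟶C ([ a ] M')

_⟵_ : Term n m → Term n m → Set
N ⟵ M = M ⟶ N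

SN : Term n m → Set
SN = Acc _⟵_

mutual
  data TType : Set where
    ν    : TType
    ω⇒ν  : TType
    _⇒ν  : SType → TType
    _∧_  : TType → TType → TType

  data SType : Set where
    _×ω : TType → SType
    _×_ : TType → SType → SType
    _∧_ : SType → SType → SType

infixr 6 _×_
infixl 5 _∧_

-- "κ is either a stack type or ω" (used in (abs) and (app))
data Tail : Set where
  ω   : Tail
  ⟨_⟩ : SType → Tail

arr : Tail → TType
arr ω     = ω⇒ν
arr ⟨ κ ⟩ = κ ⇒ν

cons : TType → Tail → SType
cons δ ω     = δ ×ω
cons δ ⟨ κ ⟩ = δ × κ

mutual
  data _≤T_ : TType → TType → Set where
    reflT   : ∀ {σ} → σ ≤T σ
    transT  : ∀ {σ τ ρ} → σ ≤T τ → τ ≤T ρ → σ ≤T ρ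
    ∧-lT    : ∀ {σ τ} → (σ ∧ τ) ≤T σ
    ∧-rT    : ∀ {σ τ} → (σ ∧ τ) ≤T τ
    ν≤ων    : ν ≤T ω⇒ν
    ων≤ν    : ω⇒ν ≤T ν
    glbT    : ∀ {σ τ₁ τ₂} → σ ≤T τ₁ → σ ≤T τ₂ → σ ≤T (τ₁ ∧ τ₂)
    arrow   : ∀ {κ₁ κ₂} → κ₂ ≤S κ₁ → (κ₁ ⇒ν) ≤T (κ₂ ⇒ν)

  data _≤S_ : SType → SType → Set where
    reflS   : ∀ {σ} → σ ≤S σ
    transS  : ∀ {σ τ ρ} → σ ≤S τ → τ ≤S ρ → σ ≤S ρ
    ∧-lS    : ∀ {σ τ} → (σ ∧ τ) ≤S σ
    ∧-rS    : ∀ {σ τ} → (σ ∧ τ) ≤S τ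
    drop    : ∀ {δ₁ δ₂} → (δ₁ × (δ₂ ×ω)) ≤S (δ₁ ×ω)
    distω   : ∀ {δ₁ δ₂ κ} → ((δ₁ ×ω) ∧ (δ₂ × κ)) ≤S ((δ₁ ∧ δ₂) × κ)
    dist    : ∀ {δ₁ δ₂ κ₁ κ₂} →
              ((δ₁ × κ₁) ∧ (δ₂ × κ₂)) ≤S ((δ₁ ∧ δ₂) × (κ₁ ∧ κ₂))
    monoω   : ∀ {δ₁ δ₂} → δ₁ ≤T δ₂ → (δ₁ ×ω) ≤S (δ₂ ×ω)
    mono    : ∀ {δ₁ δ₂ κ₁ κ₂} → δ₁ ≤T δ₂ → κ₁ ≤S κ₂ →
              (δ₁ × κ₁) ≤S (δ₂ × κ₂)
    glbS    : ∀ {σ τ₁ τ₂} → σ ≤S τ₁ → σ ≤S τ₂ → σ ≤S (τ₁ ∧ τ₂)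

data _⊢_∶_∣_ : {n m : ℕ} → Vector TType n → Term n m → TType →
               Vector SType m → Set where
  ax    : ∀ {Γ : Vector TType n} {Δ : Vector SType m} {x} →
          Γ ⊢ var x ∶ Γ x ∣ Δ
  abs   : ∀ {Γ : Vector TType n} {Δ : Vector SType m} {M δ t} →
          (δ ∷ Γ) ⊢ M ∶ arr t ∣ Δ →
          Γ ⊢ lam M ∶ (cons δ t ⇒ν) ∣ Δ
  appT  : ∀ {Γ : Vector TType n} {Δ : Vector SType m} {M N δ t} →
          Γ ⊢ M ∶ (cons δ t ⇒ν) ∣ Δ → Γ ⊢ N ∶ δ ∣ Δ →
          Γ ⊢ app M N ∶ arr t ∣ Δ
  μ-same : ∀ {Γ : Vector TType n} {Δ : Vector SType m} {M κ} →
          Γ ⊢ M ∶ (κ ⇒ν) ∣ (κ ∷ Δ) →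
          Γ ⊢ mu ([ zero ] M) ∶ (κ ⇒ν) ∣ Δ
  μ-other : ∀ {Γ : Vector TType n} {Δ : Vector SType m} {M κ} {b : Fin m} →
          Γ ⊢ M ∶ (Δ b ⇒ν) ∣ (κ ∷ Δ) →
          Γ ⊢ mu ([ suc b ] M) ∶ (κ ⇒ν) ∣ Δ
  sub≤  : ∀ {Γ : Vector TType n} {Δ : Vector SType m} {M δ δ'} →
          Γ ⊢ M ∶ δ ∣ Δ → δ ≤T δ' → Γ ⊢ M ∶ δ' ∣ Δ
  inter : ∀ {Γ : Vector TType n} {Δ : Vector SType m} {M δ δ'} →
          Γ ⊢ M ∶ δ ∣ Δ → Γ ⊢ M ∶ δ' ∣ Δ → Γ ⊢ M ∶ (δ ∧ δ') ∣ Δ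

-- A strongly normalising term is typed by well-founded induction on its
-- reduction tree, typing all its subterms along the way. Variables,
-- abstractions and μ-abstractions are typed compositionally; a neutral term
-- x N₁ … Nₖ can be given any type κ→ν, since x may be assumed to have the
-- matching arrow type; and a term whose head is a redex is typed by subject
-- expansion from its contractum and the redex's argument N. Subject expansion
-- holds because a typing of M[N/x] (resp. of C[α⇐N]) can be pulled back to a
-- typing of M (resp. C) in which x (resp. α) gets the intersection of the
-- types at which the copies of N are used, all of which are types of N.
module Submission where

open import Defs
open import Data.Nat using (ℕ; suc)
open import Data.Fin using (Fin; zero; suc)
open import Data.Fin.Properties using (_≟_)
open import Data.Product using (Σ; Σ-syntax; ∃; _,_) renaming (_×_ to _×ₚ_)
open import Data.Sum using (_⊎_; inj₁; inj₂)
open import Data.Vec.Functional using (Vector; _∷_; head; tail; updateAt; zipWith)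
open import Data.Vec.Functional.Properties using (updateAt-updates; updateAt-minimal)
open import Data.Vec.Functional.Relation.Binary.Pointwise using (Pointwise)
open import Relation.Binary.PropositionalEquality using (_≡_; refl)
open import Relation.Nullary using (yes; no)
open import Induction.WellFounded using (acc)

private
  variable
    n n' n'' m m' m'' : ℕ
    Γ Γ' Γ₀ : Vector TType n
    Δ Δ' : Vector SType m
    κ κ' : SType
    δ δ' : TType
    M N : Term n m

infix 4 _⊢ₛ_∶_∣_ _⊢ₐ_∶_∣_ _≤Γ_ _≤Δ_

-- A syntax-directed fragment of the system: Γ ⊢ₛ M ∶ κ ∣ Δ stands for
-- Γ ⊢ M ∶ κ→ν ∣ Δ, with subsumption only at variables and μ-binders, and ⊢ₐ
-- adds the intersections needed for arguments. Types κ→ν with κ a stack type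
-- suffice, and inversion of these judgements is plain pattern matching.
mutual
  data _⊢ₛ_∶_∣_ : Vector TType n → Term n m → SType → Vector SType m → Set where
    tvar     : ∀ {x} → Γ x ≤T (κ ⇒ν) → Γ ⊢ₛ var x ∶ κ ∣ Δ
    tlam     : (δ ∷ Γ) ⊢ₛ M ∶ κ ∣ Δ → Γ ⊢ₛ lam M ∶ δ × κ ∣ Δ
    tapp     : Γ ⊢ₛ M ∶ δ × κ ∣ Δ → Γ ⊢ₐ N ∶ δ ∣ Δ → Γ ⊢ₛ app M N ∶ κ ∣ Δ
    tμ-same  : Γ ⊢ₛ M ∶ κ' ∣ (κ ∷ Δ) → κ ≤S κ' →
               Γ ⊢ₛ mu ([ zero ] M) ∶ κ ∣ Δ
    tμ-other : ∀ {b} → Γ ⊢ₛ M ∶ κ' ∣ (κ ∷ Δ) → Δ b ≤S κ' →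
               Γ ⊢ₛ mu ([ suc b ] M) ∶ κ ∣ Δ

  data _⊢ₐ_∶_∣_ : Vector TType n → Term n m → TType → Vector SType m → Set where
    avar   : ∀ {x} → Γ x ≤T δ → Γ ⊢ₐ var x ∶ δ ∣ Δ
    astack : Γ ⊢ₛ M ∶ κ ∣ Δ → Γ ⊢ₐ M ∶ κ ⇒ν ∣ Δ
    a∧     : Γ ⊢ₐ M ∶ δ ∣ Δ → Γ ⊢ₐ M ∶ δ' ∣ Δ → Γ ⊢ₐ M ∶ δ ∧ δ' ∣ Δ

mutual
  ⊢ₛ-sound : Γ ⊢ₛ M ∶ κ ∣ Δ → Γ ⊢ M ∶ κ ⇒ν ∣ Δ
  ⊢ₛ-sound (tvar x≤) = sub≤ ax x≤
  ⊢ₛ-sound (tlam d) = abs {t = ⟨ _ ⟩} (⊢ₛ-sound d)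
  ⊢ₛ-sound (tapp d e) = appT {t = ⟨ _ ⟩} (⊢ₛ-sound d) (⊢ₐ-sound e)
  ⊢ₛ-sound (tμ-same d κ≤) = μ-same (sub≤ (⊢ₛ-sound d) (arrow κ≤))
  ⊢ₛ-sound (tμ-other d b≤) = μ-other (sub≤ (⊢ₛ-sound d) (arrow b≤))

  ⊢ₐ-sound : Γ ⊢ₐ M ∶ δ ∣ Δ → Γ ⊢ M ∶ δ ∣ Δ
  ⊢ₐ-sound (avar x≤) = sub≤ ax x≤
  ⊢ₐ-sound (astack d) = ⊢ₛ-sound d
  ⊢ₐ-sound (a∧ e e') = inter (⊢ₐ-sound e) (⊢ₐ-sound e')

⊢ₐ-var⁻¹ : ∀ {x} → Γ ⊢ₐ var x ∶ δ ∣ Δ → Γ x ≤T δ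
⊢ₐ-var⁻¹ (avar x≤) = x≤
⊢ₐ-var⁻¹ (astack (tvar x≤)) = x≤
⊢ₐ-var⁻¹ (a∧ e e') = glbT (⊢ₐ-var⁻¹ e) (⊢ₐ-var⁻¹ e')


_≤Γ_ : Vector TType n → Vector TType n → Set
_≤Γ_ = Pointwise _≤T_

_≤Δ_ : Vector SType m → Vector SType m → Set
_≤Δ_ = Pointwise _≤S_

≤Γ-refl : Γ ≤Γ Γ
≤Γ-refl _ = reflT

≤Δ-refl : Δ ≤Δ Δ
≤Δ-refl _ = reflS

∷-≤Γ : δ ≤T head Γ → Γ' ≤Γ tail Γ → (δ ∷ Γ') ≤Γ Γ
∷-≤Γ δ≤ Γ≤ zero = δ≤
∷-≤Γ δ≤ Γ≤ (suc i) = Γ≤ i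

∷-≤Δ : κ ≤S head Δ → Δ' ≤Δ tail Δ → (κ ∷ Δ') ≤Δ Δ
∷-≤Δ κ≤ Δ≤ zero = κ≤
∷-≤Δ κ≤ Δ≤ (suc i) = Δ≤ i

_∧Γ_ : Vector TType n → Vector TType n → Vector TType n
_∧Γ_ = zipWith _∧_

_∧Δ_ : Vector SType m → Vector SType m → Vector SType m
_∧Δ_ = zipWith _∧_

∧Γ-≤ˡ : (Γ ∧Γ Γ') ≤Γ Γ
∧Γ-≤ˡ _ = ∧-lT

∧Γ-≤ʳ : (Γ ∧Γ Γ') ≤Γ Γ'
∧Γ-≤ʳ _ = ∧-rT

∧Δ-≤ˡ : (Δ ∧Δ Δ') ≤Δ Δ
∧Δ-≤ˡ _ = ∧-lS

∧Δ-≤ʳ : (Δ ∧Δ Δ') ≤Δ Δ'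
∧Δ-≤ʳ _ = ∧-rS

mutual
  ⊢ₛ-narrow : Γ' ≤Γ Γ → Δ' ≤Δ Δ → Γ ⊢ₛ M ∶ κ ∣ Δ → Γ' ⊢ₛ M ∶ κ ∣ Δ'
  ⊢ₛ-narrow Γ≤ Δ≤ (tvar {x = x} x≤) = tvar (transT (Γ≤ x) x≤)
  ⊢ₛ-narrow Γ≤ Δ≤ (tlam d) = tlam (⊢ₛ-narrow (∷-≤Γ reflT Γ≤) Δ≤ d)
  ⊢ₛ-narrow Γ≤ Δ≤ (tapp d e) = tapp (⊢ₛ-narrow Γ≤ Δ≤ d) (⊢ₐ-narrow Γ≤ Δ≤ e)
  ⊢ₛ-narrow Γ≤ Δ≤ (tμ-same d κ≤) =
    tμ-same (⊢ₛ-narrow Γ≤ (∷-≤Δ reflS Δ≤) d) κ≤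
  ⊢ₛ-narrow Γ≤ Δ≤ (tμ-other {b = b} d b≤) =
    tμ-other (⊢ₛ-narrow Γ≤ (∷-≤Δ reflS Δ≤) d) (transS (Δ≤ b) b≤)

  ⊢ₐ-narrow : Γ' ≤Γ Γ → Δ' ≤Δ Δ → Γ ⊢ₐ M ∶ δ ∣ Δ → Γ' ⊢ₐ M ∶ δ ∣ Δ'
  ⊢ₐ-narrow Γ≤ Δ≤ (avar {x = x} x≤) = avar (transT (Γ≤ x) x≤)
  ⊢ₐ-narrow Γ≤ Δ≤ (astack d) = astack (⊢ₛ-narrow Γ≤ Δ≤ d)
  ⊢ₐ-narrow Γ≤ Δ≤ (a∧ e e') = a∧ (⊢ₐ-narrow Γ≤ Δ≤ e) (⊢ₐ-narrow Γ≤ Δ≤ e')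

mutual
  ⊢ₛ-renV : (ρ : Fin n → Fin n') → (∀ i → Γ' (ρ i) ≤T Γ i) →
            Γ ⊢ₛ M ∶ κ ∣ Δ → Γ' ⊢ₛ renV ρ M ∶ κ ∣ Δ
  ⊢ₛ-renV ρ ρ≤ (tvar {x = x} x≤) = tvar (transT (ρ≤ x) x≤)
  ⊢ₛ-renV ρ ρ≤ (tlam d) =
    tlam (⊢ₛ-renV (ext ρ) (λ { zero → reflT ; (suc i) → ρ≤ i }) d)
  ⊢ₛ-renV ρ ρ≤ (tapp d e) = tapp (⊢ₛ-renV ρ ρ≤ d) (⊢ₐ-renV ρ ρ≤ e)
  ⊢ₛ-renV ρ ρ≤ (tμ-same d κ≤) = tμ-same (⊢ₛ-renV ρ ρ≤ d) κ≤
  ⊢ₛ-renV ρ ρ≤ (tμ-other d b≤) = tμ-other (⊢ₛ-renV ρ ρ≤ d) b≤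

  ⊢ₐ-renV : (ρ : Fin n → Fin n') → (∀ i → Γ' (ρ i) ≤T Γ i) →
            Γ ⊢ₐ M ∶ δ ∣ Δ → Γ' ⊢ₐ renV ρ M ∶ δ ∣ Δ
  ⊢ₐ-renV ρ ρ≤ (avar {x = x} x≤) = avar (transT (ρ≤ x) x≤)
  ⊢ₐ-renV ρ ρ≤ (astack d) = astack (⊢ₛ-renV ρ ρ≤ d)
  ⊢ₐ-renV ρ ρ≤ (a∧ e e') = a∧ (⊢ₐ-renV ρ ρ≤ e) (⊢ₐ-renV ρ ρ≤ e')

mutual
  ⊢ₛ-renV⁻¹ : (ρ : Fin n → Fin n') (M : Term n m) → (∀ i → Γ i ≤T Γ' (ρ i)) →
              Γ' ⊢ₛ renV ρ M ∶ κ ∣ Δ → Γ ⊢ₛ M ∶ κ ∣ Δ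
  ⊢ₛ-renV⁻¹ ρ (var x) ≤ρ (tvar x≤) = tvar (transT (≤ρ x) x≤)
  ⊢ₛ-renV⁻¹ ρ (lam M) ≤ρ (tlam d) =
    tlam (⊢ₛ-renV⁻¹ (ext ρ) M (λ { zero → reflT ; (suc i) → ≤ρ i }) d)
  ⊢ₛ-renV⁻¹ ρ (app M N) ≤ρ (tapp d e) =
    tapp (⊢ₛ-renV⁻¹ ρ M ≤ρ d) (⊢ₐ-renV⁻¹ ρ N ≤ρ e)
  ⊢ₛ-renV⁻¹ ρ (mu ([ zero ] M)) ≤ρ (tμ-same d κ≤) = tμ-same (⊢ₛ-renV⁻¹ ρ M ≤ρ d) κ≤
  ⊢ₛ-renV⁻¹ ρ (mu ([ suc b ] M)) ≤ρ (tμ-other d b≤) = tμ-other (⊢ₛ-renV⁻¹ ρ M ≤ρ d) b≤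

  ⊢ₐ-renV⁻¹ : (ρ : Fin n → Fin n') (M : Term n m) → (∀ i → Γ i ≤T Γ' (ρ i)) →
              Γ' ⊢ₐ renV ρ M ∶ δ ∣ Δ → Γ ⊢ₐ M ∶ δ ∣ Δ
  ⊢ₐ-renV⁻¹ ρ (var x) ≤ρ (avar x≤) = avar (transT (≤ρ x) x≤)
  ⊢ₐ-renV⁻¹ ρ M ≤ρ (astack d) = astack (⊢ₛ-renV⁻¹ ρ M ≤ρ d)
  ⊢ₐ-renV⁻¹ ρ M ≤ρ (a∧ e e') = a∧ (⊢ₐ-renV⁻¹ ρ M ≤ρ e) (⊢ₐ-renV⁻¹ ρ M ≤ρ e')

mutual
  ⊢ₛ-renN : (ρ : Fin m → Fin m') → (∀ a → Δ' (ρ a) ≤S Δ a) →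
            Γ ⊢ₛ M ∶ κ ∣ Δ → Γ ⊢ₛ renN ρ M ∶ κ ∣ Δ'
  ⊢ₛ-renN ρ ρ≤ (tvar x≤) = tvar x≤
  ⊢ₛ-renN ρ ρ≤ (tlam d) = tlam (⊢ₛ-renN ρ ρ≤ d)
  ⊢ₛ-renN ρ ρ≤ (tapp d e) = tapp (⊢ₛ-renN ρ ρ≤ d) (⊢ₐ-renN ρ ρ≤ e)
  ⊢ₛ-renN ρ ρ≤ (tμ-same d κ≤) =
    tμ-same (⊢ₛ-renN (ext ρ) (λ { zero → reflS ; (suc a) → ρ≤ a }) d) κ≤
  ⊢ₛ-renN ρ ρ≤ (tμ-other {b = b} d b≤) =
    tμ-other (⊢ₛ-renN (ext ρ) (λ { zero → reflS ; (suc a) → ρ≤ a }) d) (transS (ρ≤ b) b≤)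

  ⊢ₐ-renN : (ρ : Fin m → Fin m') → (∀ a → Δ' (ρ a) ≤S Δ a) →
            Γ ⊢ₐ M ∶ δ ∣ Δ → Γ ⊢ₐ renN ρ M ∶ δ ∣ Δ'
  ⊢ₐ-renN ρ ρ≤ (avar x≤) = avar x≤
  ⊢ₐ-renN ρ ρ≤ (astack d) = astack (⊢ₛ-renN ρ ρ≤ d)
  ⊢ₐ-renN ρ ρ≤ (a∧ e e') = a∧ (⊢ₐ-renN ρ ρ≤ e) (⊢ₐ-renN ρ ρ≤ e')

mutual
  ⊢ₛ-renN⁻¹ : (ρ : Fin m → Fin m') (M : Term n m) → (∀ a → Δ a ≤S Δ' (ρ a)) →
              Γ ⊢ₛ renN ρ M ∶ κ ∣ Δ' → Γ ⊢ₛ M ∶ κ ∣ Δ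
  ⊢ₛ-renN⁻¹ ρ (var x) ≤ρ (tvar x≤) = tvar x≤
  ⊢ₛ-renN⁻¹ ρ (lam M) ≤ρ (tlam d) = tlam (⊢ₛ-renN⁻¹ ρ M ≤ρ d)
  ⊢ₛ-renN⁻¹ ρ (app M N) ≤ρ (tapp d e) =
    tapp (⊢ₛ-renN⁻¹ ρ M ≤ρ d) (⊢ₐ-renN⁻¹ ρ N ≤ρ e)
  ⊢ₛ-renN⁻¹ ρ (mu ([ zero ] M)) ≤ρ (tμ-same d κ≤) =
    tμ-same (⊢ₛ-renN⁻¹ (ext ρ) M (λ { zero → reflS ; (suc a) → ≤ρ a }) d) κ≤
  ⊢ₛ-renN⁻¹ ρ (mu ([ suc b ] M)) ≤ρ (tμ-other d b≤) =
    tμ-other (⊢ₛ-renN⁻¹ (ext ρ) M (λ { zero → reflS ; (suc a) → ≤ρ a }) d)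
             (transS (≤ρ b) b≤)

  ⊢ₐ-renN⁻¹ : (ρ : Fin m → Fin m') (M : Term n m) → (∀ a → Δ a ≤S Δ' (ρ a)) →
              Γ ⊢ₐ renN ρ M ∶ δ ∣ Δ' → Γ ⊢ₐ M ∶ δ ∣ Δ
  ⊢ₐ-renN⁻¹ ρ (var x) ≤ρ (avar x≤) = avar x≤
  ⊢ₐ-renN⁻¹ ρ M ≤ρ (astack d) = astack (⊢ₛ-renN⁻¹ ρ M ≤ρ d)
  ⊢ₐ-renN⁻¹ ρ M ≤ρ (a∧ e e') = a∧ (⊢ₐ-renN⁻¹ ρ M ≤ρ e) (⊢ₐ-renN⁻¹ ρ M ≤ρ e')

⊢ₐ-weakenV : Γ ⊢ₐ M ∶ δ ∣ Δ → (δ' ∷ Γ) ⊢ₐ renV suc M ∶ δ ∣ Δ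
⊢ₐ-weakenV = ⊢ₐ-renV suc (λ _ → reflT)

⊢ₐ-strengthenV : (δ' ∷ Γ) ⊢ₐ renV suc M ∶ δ ∣ Δ → Γ ⊢ₐ M ∶ δ ∣ Δ
⊢ₐ-strengthenV {M = M} = ⊢ₐ-renV⁻¹ suc M (λ _ → reflT)

⊢ₐ-weakenN : Γ ⊢ₐ M ∶ δ ∣ Δ → Γ ⊢ₐ renN suc M ∶ δ ∣ (κ ∷ Δ)
⊢ₐ-weakenN = ⊢ₐ-renN suc (λ _ → reflS)

⊢ₐ-strengthenN : Γ ⊢ₐ renN suc M ∶ δ ∣ (κ ∷ Δ) → Γ ⊢ₐ M ∶ δ ∣ Δ
⊢ₐ-strengthenN {M = M} = ⊢ₐ-renN⁻¹ suc M (λ _ → reflS)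

_⊢ₐ*_∶_∣_ : Vector TType n' → (Fin n → Term n' m) → Vector TType n → Vector SType m → Set
Γ ⊢ₐ* σ ∶ Γ₀ ∣ Δ = ∀ i → Γ ⊢ₐ σ i ∶ Γ₀ i ∣ Δ

⊢ₐ*-∧ : ∀ {σ : Fin n → Term n' m} {Γ₁ Γ₂} →
        Γ ⊢ₐ* σ ∶ Γ₁ ∣ Δ → Γ ⊢ₐ* σ ∶ Γ₂ ∣ Δ → Γ ⊢ₐ* σ ∶ Γ₁ ∧Γ Γ₂ ∣ Δ
⊢ₐ*-∧ σ₁ σ₂ i = a∧ (σ₁ i) (σ₂ i)

⊢ₐ*-exts : ∀ {σ : Fin n → Term n' m} →
           Γ ⊢ₐ* σ ∶ Γ₀ ∣ Δ → (δ ∷ Γ) ⊢ₐ* exts σ ∶ δ ∷ Γ₀ ∣ Δ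
⊢ₐ*-exts hσ zero = avar reflT
⊢ₐ*-exts hσ (suc i) = ⊢ₐ-weakenV (hσ i)

⊢ₐ*-weakenN : ∀ {σ : Fin n → Term n' m} →
              Γ ⊢ₐ* σ ∶ Γ₀ ∣ Δ → Γ ⊢ₐ* (λ i → renN suc (σ i)) ∶ Γ₀ ∣ (κ ∷ Δ)
⊢ₐ*-weakenN hσ i = ⊢ₐ-weakenN (hσ i)

⊢ₐ*-strengthenN : ∀ {σ : Fin n → Term n' m} →
                  Γ ⊢ₐ* (λ i → renN suc (σ i)) ∶ Γ₀ ∣ (κ ∷ Δ) → Γ ⊢ₐ* σ ∶ Γ₀ ∣ Δ
⊢ₐ*-strengthenN hσ i = ⊢ₐ-strengthenN (hσ i)

updateAt-∧-≤ : (x : Fin n) (Γ₀ : Vector TType n) → updateAt Γ₀ x (_∧ δ) x ≤T δ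
updateAt-∧-≤ {δ = δ} x Γ₀ rewrite updateAt-updates x {_∧ δ} Γ₀ = ∧-rT

⊢ₐ*-updateAt : ∀ {σ : Fin n → Term n' m} {x} →
               Γ ⊢ₐ* σ ∶ Γ₀ ∣ Δ → Γ ⊢ₐ σ x ∶ δ ∣ Δ → Γ ⊢ₐ* σ ∶ updateAt Γ₀ x (_∧ δ) ∣ Δ
⊢ₐ*-updateAt {Γ₀ = Γ₀} {δ = δ} {x = x} hσ hx i with i ≟ x
... | yes refl rewrite updateAt-updates x {_∧ δ} Γ₀ = a∧ (hσ x) hx
... | no i≢x rewrite updateAt-minimal i x {_∧ δ} Γ₀ i≢x = hσ i

-- Γ₀ is a typing of σ that is assumed to exist; it supplies the types of the
-- variables that do not occur in M.
mutual
  ⊢ₛ-unsub : (M : Term n m) (σ : Fin n → Term n' m) →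
             Γ ⊢ₛ sub σ M ∶ κ ∣ Δ → Γ ⊢ₐ* σ ∶ Γ₀ ∣ Δ →
             Σ[ Γ₁ ∈ Vector TType n ] Γ₁ ⊢ₛ M ∶ κ ∣ Δ ×ₚ Γ ⊢ₐ* σ ∶ Γ₁ ∣ Δ
  ⊢ₛ-unsub {κ = κ} {Γ₀ = Γ₀} (var x) σ d hσ =
    updateAt Γ₀ x (_∧ (κ ⇒ν)) , tvar (updateAt-∧-≤ x Γ₀) , ⊢ₐ*-updateAt hσ (astack d)
  ⊢ₛ-unsub (lam P) σ (tlam d) hσ with ⊢ₛ-unsub P (exts σ) d (⊢ₐ*-exts hσ)
  ... | Γ₁ , dP , hσ₁ =
    tail Γ₁ , tlam (⊢ₛ-narrow (∷-≤Γ (⊢ₐ-var⁻¹ (hσ₁ zero)) ≤Γ-refl) ≤Δ-refl dP) ,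
    λ i → ⊢ₐ-strengthenV (hσ₁ (suc i))
  ⊢ₛ-unsub (app P Q) σ (tapp d e) hσ with ⊢ₛ-unsub P σ d hσ | ⊢ₐ-unsub Q σ e hσ
  ... | Γ₁ , dP , hσ₁ | Γ₂ , eQ , hσ₂ =
    Γ₁ ∧Γ Γ₂ ,
    tapp (⊢ₛ-narrow ∧Γ-≤ˡ ≤Δ-refl dP) (⊢ₐ-narrow ∧Γ-≤ʳ ≤Δ-refl eQ) ,
    ⊢ₐ*-∧ hσ₁ hσ₂
  ⊢ₛ-unsub (mu ([ zero ] P)) σ (tμ-same d κ≤) hσ
    with ⊢ₛ-unsub P (λ i → renN suc (σ i)) d (⊢ₐ*-weakenN hσ)
  ... | Γ₁ , dP , hσ₁ = Γ₁ , tμ-same dP κ≤ , ⊢ₐ*-strengthenN hσ₁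
  ⊢ₛ-unsub (mu ([ suc b ] P)) σ (tμ-other d b≤) hσ
    with ⊢ₛ-unsub P (λ i → renN suc (σ i)) d (⊢ₐ*-weakenN hσ)
  ... | Γ₁ , dP , hσ₁ = Γ₁ , tμ-other dP b≤ , ⊢ₐ*-strengthenN hσ₁

  ⊢ₐ-unsub : (M : Term n m) (σ : Fin n → Term n' m) →
             Γ ⊢ₐ sub σ M ∶ δ ∣ Δ → Γ ⊢ₐ* σ ∶ Γ₀ ∣ Δ →
             Σ[ Γ₁ ∈ Vector TType n ] Γ₁ ⊢ₐ M ∶ δ ∣ Δ ×ₚ Γ ⊢ₐ* σ ∶ Γ₁ ∣ Δ
  ⊢ₐ-unsub {δ = δ} {Γ₀ = Γ₀} (var x) σ e hσ =
    updateAt Γ₀ x (_∧ δ) , avar (updateAt-∧-≤ x Γ₀) , ⊢ₐ*-updateAt hσ e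
  ⊢ₐ-unsub M σ (astack d) hσ with ⊢ₛ-unsub M σ d hσ
  ... | Γ₁ , dM , hσ₁ = Γ₁ , astack dM , hσ₁
  ⊢ₐ-unsub M σ (a∧ e e') hσ with ⊢ₐ-unsub M σ e hσ | ⊢ₐ-unsub M σ e' hσ
  ... | Γ₁ , e₁ , hσ₁ | Γ₂ , e₂ , hσ₂ =
    Γ₁ ∧Γ Γ₂ , a∧ (⊢ₐ-narrow ∧Γ-≤ˡ ≤Δ-refl e₁) (⊢ₐ-narrow ∧Γ-≤ʳ ≤Δ-refl e₂) ,
    ⊢ₐ*-∧ hσ₁ hσ₂

≤S-reflexive : κ ≡ κ' → κ ≤S κ'
≤S-reflexive refl = reflS

updateAt-mono : {f g : SType → SType} (Δ : Vector SType m) (a : Fin m) →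
                (∀ κ → f κ ≤S g κ) → updateAt Δ a f ≤Δ updateAt Δ a g
updateAt-mono Δ zero f≤g zero = f≤g (head Δ)
updateAt-mono Δ zero f≤g (suc i) = reflS
updateAt-mono Δ (suc a) f≤g zero = reflS
updateAt-mono Δ (suc a) f≤g (suc i) = updateAt-mono (tail Δ) a f≤g i

updateAt-×-∧ˡ : (Δ : Vector SType m) (a : Fin m) →
                updateAt Δ a ((δ ∧ δ') ×_) ≤Δ updateAt Δ a (δ ×_)
updateAt-×-∧ˡ Δ a = updateAt-mono Δ a (λ _ → mono ∧-lT reflS)

updateAt-×-∧ʳ : (Δ : Vector SType m) (a : Fin m) →
                updateAt Δ a ((δ ∧ δ') ×_) ≤Δ updateAt Δ a (δ' ×_)
updateAt-×-∧ʳ Δ a = updateAt-mono Δ a (λ _ → mono ∧-rT reflS)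

∷-updateAt : {f : SType → SType} (Δ : Vector SType m) (a : Fin m) →
             (κ ∷ updateAt Δ a f) ≤Δ updateAt (κ ∷ Δ) (suc a) f
∷-updateAt Δ a = ∷-≤Δ reflS ≤Δ-refl

-- δ is a type of L assumed to exist, used when α does not occur in M.
mutual
  ⊢ₛ-unstr : (M : Term n m) (a : Fin m) (L : Term n m) →
             Γ ⊢ₛ strT a L M ∶ κ ∣ Δ → Γ ⊢ₐ L ∶ δ ∣ Δ →
             Σ[ δ₁ ∈ TType ] Γ ⊢ₛ M ∶ κ ∣ updateAt Δ a (δ₁ ×_) ×ₚ Γ ⊢ₐ L ∶ δ₁ ∣ Δ
  ⊢ₛ-unstr {δ = δ} (var x) a L (tvar x≤) eL = δ , tvar x≤ , eL
  ⊢ₛ-unstr (lam P) a L (tlam d) eL with ⊢ₛ-unstr P a (renV suc L) d (⊢ₐ-weakenV eL)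
  ... | δ₁ , dP , eL₁ = δ₁ , tlam dP , ⊢ₐ-strengthenV eL₁
  ⊢ₛ-unstr {Δ = Δ} (app P Q) a L (tapp d e) eL
    with ⊢ₛ-unstr P a L d eL | ⊢ₐ-unstr Q a L e eL
  ... | δ₁ , dP , eL₁ | δ₂ , eQ , eL₂ =
    δ₁ ∧ δ₂ ,
    tapp (⊢ₛ-narrow ≤Γ-refl (updateAt-×-∧ˡ Δ a) dP)
         (⊢ₐ-narrow ≤Γ-refl (updateAt-×-∧ʳ Δ a) eQ) ,
    a∧ eL₁ eL₂
  ⊢ₛ-unstr {Δ = Δ} (mu ([ zero ] P)) a L (tμ-same d κ≤) eL
    with ⊢ₛ-unstr P (suc a) (renN suc L) d (⊢ₐ-weakenN eL)
  ... | δ₁ , dP , eL₁ =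
    δ₁ , tμ-same (⊢ₛ-narrow ≤Γ-refl (∷-updateAt Δ a) dP) κ≤ , ⊢ₐ-strengthenN eL₁
  ⊢ₛ-unstr (mu ([ suc b ] P)) a L d eL with b ≟ a
  ⊢ₛ-unstr {Δ = Δ} (mu ([ suc b ] P)) a L (tμ-other {κ = κ} (tapp d eL₂) b≤) eL | yes refl
    with ⊢ₛ-unstr P (suc a) (renN suc L) d (⊢ₐ-weakenN eL)
  ... | δ₁ , dP , eL₁ =
    δ₁ ∧ _ ,
    tμ-other (⊢ₛ-narrow ≤Γ-refl
               (λ i → transS (∷-updateAt Δ a i) (updateAt-×-∧ˡ (κ ∷ Δ) (suc a) i)) dP)
             (transS (≤S-reflexive (updateAt-updates a Δ)) (mono ∧-rT b≤)) ,
    a∧ (⊢ₐ-strengthenN eL₁) (⊢ₐ-strengthenN eL₂)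
  ⊢ₛ-unstr {Δ = Δ} (mu ([ suc b ] P)) a L (tμ-other d b≤) eL | no b≢a
    with ⊢ₛ-unstr P (suc a) (renN suc L) d (⊢ₐ-weakenN eL)
  ... | δ₁ , dP , eL₁ =
    δ₁ ,
    tμ-other (⊢ₛ-narrow ≤Γ-refl (∷-updateAt Δ a) dP)
             (transS (≤S-reflexive (updateAt-minimal b a Δ b≢a)) b≤) ,
    ⊢ₐ-strengthenN eL₁

  ⊢ₐ-unstr : (M : Term n m) (a : Fin m) (L : Term n m) →
             Γ ⊢ₐ strT a L M ∶ δ' ∣ Δ → Γ ⊢ₐ L ∶ δ ∣ Δ →
             Σ[ δ₁ ∈ TType ] Γ ⊢ₐ M ∶ δ' ∣ updateAt Δ a (δ₁ ×_) ×ₚ Γ ⊢ₐ L ∶ δ₁ ∣ Δ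
  ⊢ₐ-unstr {δ = δ} (var x) a L e eL = δ , avar (⊢ₐ-var⁻¹ e) , eL
  ⊢ₐ-unstr M a L (astack d) eL with ⊢ₛ-unstr M a L d eL
  ... | δ₁ , dM , eL₁ = δ₁ , astack dM , eL₁
  ⊢ₐ-unstr {Δ = Δ} M a L (a∧ e e') eL with ⊢ₐ-unstr M a L e eL | ⊢ₐ-unstr M a L e' eL
  ... | δ₁ , e₁ , eL₁ | δ₂ , e₂ , eL₂ =
    δ₁ ∧ δ₂ ,
    a∧ (⊢ₐ-narrow ≤Γ-refl (updateAt-×-∧ˡ Δ a) e₁)
       (⊢ₐ-narrow ≤Γ-refl (updateAt-×-∧ʳ Δ a) e₂) ,
    a∧ eL₁ eL₂

⊢ₛ-β-expand : (P : Term (suc n) m) →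
              Γ ⊢ₛ P [ N /0] ∶ κ ∣ Δ → Γ ⊢ₐ N ∶ δ ∣ Δ → Γ ⊢ₛ app (lam P) N ∶ κ ∣ Δ
⊢ₛ-β-expand {Γ = Γ} {δ = δ} P d eN
  with ⊢ₛ-unsub {Γ₀ = δ ∷ Γ} P _ d (λ { zero → eN ; (suc i) → avar reflT })
... | Γ₁ , dP , hσ =
  tapp (tlam (⊢ₛ-narrow (∷-≤Γ reflT (λ i → ⊢ₐ-var⁻¹ (hσ (suc i)))) ≤Δ-refl dP)) (hσ zero)

⊢ₛ-μ-expand : (C : Cmd n (suc m)) →
              Γ ⊢ₛ mu (strC zero (renN suc N) C) ∶ κ ∣ Δ → Γ ⊢ₐ N ∶ δ ∣ Δ →
              Γ ⊢ₛ app (mu C) N ∶ κ ∣ Δ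
⊢ₛ-μ-expand {N = N} ([ zero ] P) (tμ-same (tapp d eN₂) κ≤) eN
  with ⊢ₛ-unstr P zero (renN suc N) d (⊢ₐ-weakenN eN)
... | δ₁ , dP , eN₁ =
  tapp (tμ-same (⊢ₛ-narrow ≤Γ-refl (∷-≤Δ (mono ∧-lT reflS) ≤Δ-refl) dP) (mono ∧-rT κ≤))
       (a∧ (⊢ₐ-strengthenN eN₁) (⊢ₐ-strengthenN eN₂))
⊢ₛ-μ-expand {N = N} ([ suc b ] P) (tμ-other d b≤) eN
  with ⊢ₛ-unstr P zero (renN suc N) d (⊢ₐ-weakenN eN)
... | δ₁ , dP , eN₁ =
  tapp (tμ-other (⊢ₛ-narrow ≤Γ-refl (∷-≤Δ reflS ≤Δ-refl) dP) b≤) (⊢ₐ-strengthenN eN₁)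

data HeadRedex {n m} : Term n m → Set where
  β-redex : {P : Term (suc n) m} {N : Term n m} → HeadRedex (app (lam P) N)
  μ-redex : {C : Cmd n (suc m)} {N : Term n m} → HeadRedex (app (mu C) N)
  appˡ    : {M N : Term n m} → HeadRedex M → HeadRedex (app M N)

contract : {M : Term n m} → HeadRedex M → Term n m
contract (β-redex {P = P} {N = N}) = P [ N /0]
contract (μ-redex {C = C} {N = N}) = mu (strC zero (renN suc N) C)
contract (appˡ {N = N} r) = app (contract r) N

redexArg : {M : Term n m} → HeadRedex M → Term n m
redexArg (β-redex {N = N}) = N
redexArg (μ-redex {N = N}) = N
redexArg (appˡ r) = redexArg r

⟶-contract : (r : HeadRedex M) → M ⟶ contract r
⟶-contract β-redex = β
⟶-contract μ-redex = μred
⟶-contract (appˡ r) = ξl (⟶-contract r)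

⊢ₛ-head-expand : (r : HeadRedex M) →
                 Γ ⊢ₛ contract r ∶ κ ∣ Δ → Γ ⊢ₐ redexArg r ∶ δ ∣ Δ → Γ ⊢ₛ M ∶ κ ∣ Δ
⊢ₛ-head-expand (β-redex {P = P}) d eN = ⊢ₛ-β-expand P d eN
⊢ₛ-head-expand (μ-redex {C = C}) d eN = ⊢ₛ-μ-expand C d eN
⊢ₛ-head-expand (appˡ r) (tapp d e) eN = tapp (⊢ₛ-head-expand r d eN) e

data Neutral {n m} : Term n m → Set where
  var : ∀ {x} → Neutral (var x)
  app : {M N : Term n m} → Neutral M → Neutral (app M N)

neutral-or-headRedex : (M N : Term n m) → Neutral (app M N) ⊎ HeadRedex (app M N)
neutral-or-headRedex (var x) N = inj₁ (app var)
neutral-or-headRedex (lam P) N = inj₂ β-redex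
neutral-or-headRedex (mu C) N = inj₂ μ-redex
neutral-or-headRedex (app M M') N with neutral-or-headRedex M M'
... | inj₁ ne = inj₁ (app ne)
... | inj₂ r = inj₂ (appˡ r)

infix 4 _⊑_

data _⊑_ {n' m'} (S : Term n' m') : Term n m → Set where
  ⊑-refl : S ⊑ S
  ⊑-lam  : {P : Term (suc n) m} → S ⊑ P → S ⊑ lam P
  ⊑-appˡ : {M N : Term n m} → S ⊑ M → S ⊑ app M N
  ⊑-appʳ : {M N : Term n m} → S ⊑ N → S ⊑ app M N
  ⊑-mu   : ∀ {a} {P : Term n (suc m)} → S ⊑ P → S ⊑ mu ([ a ] P)

⊑-trans : {S : Term n m} {S' : Term n' m'} {T : Term n'' m''} → S ⊑ S' → S' ⊑ T → S ⊑ T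
⊑-trans p ⊑-refl = p
⊑-trans p (⊑-lam q) = ⊑-lam (⊑-trans p q)
⊑-trans p (⊑-appˡ q) = ⊑-appˡ (⊑-trans p q)
⊑-trans p (⊑-appʳ q) = ⊑-appʳ (⊑-trans p q)
⊑-trans p (⊑-mu q) = ⊑-mu (⊑-trans p q)

⊑-⟶ : {S S' : Term n' m'} {T : Term n m} → S ⊑ T → S ⟶ S' →
      Σ[ T' ∈ Term n m ] T ⟶ T' ×ₚ S' ⊑ T'
⊑-⟶ ⊑-refl s = _ , s , ⊑-refl
⊑-⟶ (⊑-lam p) s with ⊑-⟶ p s
... | _ , t , q = _ , ξlam t , ⊑-lam q
⊑-⟶ (⊑-appˡ p) s with ⊑-⟶ p s
... | _ , t , q = _ , ξl t , ⊑-appˡ q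
⊑-⟶ (⊑-appʳ p) s with ⊑-⟶ p s
... | _ , t , q = _ , ξr t , ⊑-appʳ q
⊑-⟶ (⊑-mu p) s with ⊑-⟶ p s
... | _ , t , q = _ , ξmu (ξcmd t) , ⊑-mu q

TypableAt : Term n m → SType → Set
TypableAt {n} {m} M κ = Σ[ Γ ∈ Vector TType n ] Σ[ Δ ∈ Vector SType m ] Γ ⊢ₛ M ∶ κ ∣ Δ

Typable : Term n m → Set
Typable M = ∃ (TypableAt M)

typableAt-var : ∀ {x : Fin n} → TypableAt {m = m} (var x) κ
typableAt-var {κ = κ} = (λ _ → κ ⇒ν) , (λ _ → ν ×ω) , tvar reflT

typableAt-app : TypableAt M ((κ' ⇒ν) × κ) → TypableAt N κ' → TypableAt (app M N) κ
typableAt-app (Γ₁ , Δ₁ , d) (Γ₂ , Δ₂ , e) =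
  Γ₁ ∧Γ Γ₂ , Δ₁ ∧Δ Δ₂ ,
  tapp (⊢ₛ-narrow ∧Γ-≤ˡ ∧Δ-≤ˡ d) (astack (⊢ₛ-narrow ∧Γ-≤ʳ ∧Δ-≤ʳ e))

typable-lam : {P : Term (suc n) m} → Typable P → Typable (lam P)
typable-lam (κ , Γ , Δ , d) =
  head Γ × κ , tail Γ , Δ , tlam (⊢ₛ-narrow (∷-≤Γ reflT ≤Γ-refl) ≤Δ-refl d)

typable-mu : (a : Fin (suc m)) {P : Term n (suc m)} → Typable P → Typable (mu ([ a ] P))
typable-mu zero (κ , Γ , Δ , d) =
  head Δ ∧ κ , Γ , tail Δ , tμ-same (⊢ₛ-narrow ≤Γ-refl (∷-≤Δ ∧-lS ≤Δ-refl) d) ∧-rS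
typable-mu (suc b) (κ , Γ , Δ , d) =
  head Δ , Γ , tail Δ ∧Δ (λ _ → κ) ,
  tμ-other (⊢ₛ-narrow ≤Γ-refl (∷-≤Δ reflS ∧Δ-≤ˡ) d) ∧-rS

typable-head-expand : (r : HeadRedex M) → Typable (contract r) → Typable (redexArg r) → Typable M
typable-head-expand r (κ , Γ₁ , Δ₁ , d) (κ' , Γ₂ , Δ₂ , e) =
  κ , Γ₁ ∧Γ Γ₂ , Δ₁ ∧Δ Δ₂ ,
  ⊢ₛ-head-expand r (⊢ₛ-narrow ∧Γ-≤ˡ ∧Δ-≤ˡ d) (astack (⊢ₛ-narrow ∧Γ-≤ʳ ∧Δ-≤ʳ e))

-- Subterms S of T are typed by recursion on the accessibility proof of T,
-- lexicographically followed by S: reducing S reduces T.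
mutual
  typable-⊑ : (T : Term n m) → SN T → (S : Term n' m') → S ⊑ T → Typable S
  typable-⊑ T sn (var x) _ = ν ×ω , typableAt-var
  typable-⊑ T sn (lam P) S⊑T = typable-lam (typable-⊑ T sn P (⊑-trans (⊑-lam ⊑-refl) S⊑T))
  typable-⊑ T sn (mu ([ a ] P)) S⊑T =
    typable-mu a (typable-⊑ T sn P (⊑-trans (⊑-mu ⊑-refl) S⊑T))
  typable-⊑ T sn (app M N) S⊑T =
    typable-neutral-or-headRedex T sn (app M N) S⊑T (neutral-or-headRedex M N)

  typable-neutral-or-headRedex : (T : Term n m) → SN T → (S : Term n' m') → S ⊑ T →
                                 Neutral S ⊎ HeadRedex S → Typable S
  typable-neutral-or-headRedex T sn S S⊑T (inj₁ ne) = ν ×ω , typableAt-neutral T sn S S⊑T ne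
  typable-neutral-or-headRedex T sn S S⊑T (inj₂ r) = typable-headRedex T sn S S⊑T r

  typableAt-neutral : (T : Term n m) → SN T → (S : Term n' m') → S ⊑ T → Neutral S →
                      TypableAt S κ
  typableAt-neutral T sn (var x) _ var = typableAt-var
  typableAt-neutral T sn (app M N) S⊑T (app ne) =
    let κ' , tN = typable-⊑ T sn N (⊑-trans (⊑-appʳ ⊑-refl) S⊑T)
    in typableAt-app (typableAt-neutral T sn M (⊑-trans (⊑-appˡ ⊑-refl) S⊑T) ne) tN

  typable-headRedex : (T : Term n m) → SN T → (S : Term n' m') → S ⊑ T → HeadRedex S →
                      Typable S
  typable-headRedex T sn@(acc rs) S S⊑T r =
    let T' , T⟶T' , S'⊑T' = ⊑-⟶ S⊑T (⟶-contract r)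
    in typable-head-expand r (typable-⊑ T' (rs T⟶T') (contract r) S'⊑T')
                             (typable-redexArg T sn S S⊑T r)

  typable-redexArg : (T : Term n m) → SN T → (S : Term n' m') → S ⊑ T →
                     (r : HeadRedex S) → Typable (redexArg r)
  typable-redexArg T sn (app _ N) S⊑T β-redex = typable-⊑ T sn N (⊑-trans (⊑-appʳ ⊑-refl) S⊑T)
  typable-redexArg T sn (app _ N) S⊑T μ-redex = typable-⊑ T sn N (⊑-trans (⊑-appʳ ⊑-refl) S⊑T)
  typable-redexArg T sn (app M _) S⊑T (appˡ r) =
    typable-redexArg T sn M (⊑-trans (⊑-appˡ ⊑-refl) S⊑T) r

theorem2p24 : {n m : ℕ} (M : Term n m) → SN M →
    Σ (Vector TType n) λ Γ → Σ (Vector SType m) λ Δ → ∃ λ δ → Γ ⊢ M ∶ δ ∣ Δ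
theorem2p24 M sn =
  let κ , Γ , Δ , d = typable-⊑ M sn M ⊑-refl
  in Γ , Δ , κ ⇒ν , ⊢ₛ-sound d
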